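{- Deciding whether a SAT instance (a Boolean formula in conjunctive normal form) is satisfiable can be reduced to finding the true proof number of the root of a directed acyclic AND/OR graph. Likewise, it can be reduced to finding the true disproof number of the root of a directed acyclic AND/OR graph.
   Context: A directed acyclic AND/OR graph is a finite directed acyclic graph $G=\langle V_o,V_a,E\rangle$ whose nodes are partitioned into OR nodes $V_o$ and AND nodes $V_a$. Nodes with no outgoing edges are leaves. A leaf is either terminal, with a known status (solvable or unsolvable), or non-terminal, with unknown status. Solvability propagates upward as follows. An OR node is solvable iff at least one of its children is solvable, and it is unsolvable iff all of its children are unsolvable. An AND node is solvable iff all of its children are solvable, and it is unsolvable iff at least one child is unsolvable. The true proof number $p(x)$ of a node $x$ is the minimum number of non-terminal leaf descendants of $x$ that must be solved (shown solvable) in order to prove that $x$ is solvable. Equivalently, it is the minimum cardinality of a set $S$ of non-terminal leaves such that, if every leaf in $S$ is solvable, then $x$ is solvable. It is $0$ if $x$ is already solvable, and $\infty$ if no such $S$ exists. The true disproof number $d(x)$ is defined dually. It is the minimum number of non-terminal leaf descendants that must be shown unsolvable in order to show that $x$ is unsolvable. These true values count each leaf once, even when the leaf is reachable along several paths. They therefore generally differ from the tree-recursive values (min/sum rules) in a DAG. -}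

module Defs where

open import Data.Nat using (ℕ; _≤_; _<_)
open import Data.Bool using (Bool; true; false; not)
open import Data.Fin using (Fin)
open import Data.List using (List; []; _∷_; _++_; map; length; lookup; allFin)
open import Data.List.Relation.Unary.All using (All)
open import Data.List.Relation.Unary.Any using (Any)
open import Data.List.Membership.Propositional using (_∈_)
open import Data.List.Relation.Unary.Unique.Propositional using (Unique)
open import Data.Product using (Σ; _×_; ∃)
open import Relation.Binary.PropositionalEquality using (_≡_; _≢_)

data Kind : Set where
  OR AND : Kind

-- Status of a leaf: terminal solvable, terminal unsolvable, or
-- non-terminal (unknown).  Ignored for non-leaf nodes.
data Status : Set where
  solvable unsolvable unknown : Status

record AOGraph : Set₁ where
  field
    V        : Set
    kind     : V → Kind
    children : V → List V
    status   : V → Status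
open AOGraph public

Finite : AOGraph → Set
Finite G = Σ (List (V G)) λ nodes → ∀ v → v ∈ nodes

Acyclic : AOGraph → Set
Acyclic G = Σ (V G → ℕ) λ rank → ∀ v c → c ∈ children G v → rank c < rank v

NonTerminalLeaf : (G : AOGraph) → V G → Set
NonTerminalLeaf G v = children G v ≡ [] × status G v ≡ unknown

Admissible : (G : AOGraph) → List (V G) → Set
Admissible G S = Unique S × All (NonTerminalLeaf G) S

-- Solved G S x : x is solvable once every leaf of S is known to be
-- solvable (propagation rules for OR/AND nodes).
data Solved (G : AOGraph) (S : List (V G)) : V G → Set where
  leaf-term : ∀ {v} → children G v ≡ [] → status G v ≡ solvable → Solved G S v
  leaf-S    : ∀ {v} → children G v ≡ [] → v ∈ S → Solved G S v
  or-node   : ∀ {v} → kind G v ≡ OR → Any (Solved G S) (children G v) → Solved G S v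
  and-node  : ∀ {v} → kind G v ≡ AND → children G v ≢ [] →
              All (Solved G S) (children G v) → Solved G S v

data Disproved (G : AOGraph) (S : List (V G)) : V G → Set where
  leaf-term : ∀ {v} → children G v ≡ [] → status G v ≡ unsolvable → Disproved G S v
  leaf-S    : ∀ {v} → children G v ≡ [] → v ∈ S → Disproved G S v
  or-node   : ∀ {v} → kind G v ≡ OR → children G v ≢ [] →
              All (Disproved G S) (children G v) → Disproved G S v
  and-node  : ∀ {v} → kind G v ≡ AND → Any (Disproved G S) (children G v) → Disproved G S v

ProofNumber : (G : AOGraph) → V G → ℕ → Set
ProofNumber G x k =
  (Σ (List (V G)) λ S → Admissible G S × length S ≡ k × Solved G S x) ×
  (∀ S → Admissible G S → Solved G S x → k ≤ length S)

DisproofNumber : (G : AOGraph) → V G → ℕ → Set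
DisproofNumber G x k =
  (Σ (List (V G)) λ S → Admissible G S × length S ≡ k × Disproved G S x) ×
  (∀ S → Admissible G S → Disproved G S x → k ≤ length S)

data Lit (n : ℕ) : Set where
  pos neg : Fin n → Lit n

Clause : ℕ → Set
Clause n = List (Lit n)

CNF : ℕ → Set
CNF n = List (Clause n)

evalLit : ∀ {n} → (Fin n → Bool) → Lit n → Bool
evalLit ρ (pos i) = ρ i
evalLit ρ (neg i) = not (ρ i)

Satisfiable : ∀ {n} → CNF n → Set
Satisfiable {n} φ = ∃ λ (ρ : Fin n → Bool) →
  All (λ C → Any (λ l → evalLit ρ l ≡ true) C) φ

data RNode (n m : ℕ) : Set where
  root tt ff : RNode n m
  lit        : Lit n → RNode n m
  var        : Fin n → RNode n m
  cls        : Fin m → RNode n m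

pnGraph : ∀ {n} → CNF n → AOGraph
pnGraph {n} φ = record
  { V        = RNode n (length φ)
  ; kind     = knd
  ; children = ch
  ; status   = st
  }
  where
  knd : RNode n (length φ) → Kind
  knd root = AND
  knd _    = OR
  ch : RNode n (length φ) → List (RNode n (length φ))
  ch root    = tt ∷ (map var (allFin n) ++ map cls (allFin (length φ)))
  ch (var i) = lit (pos i) ∷ lit (neg i) ∷ []
  ch (cls j) = ff ∷ map lit (lookup φ j)
  ch _       = []
  st : RNode n (length φ) → Status
  st tt = solvable
  st ff = unsolvable
  st _  = unknown

dualKind : Kind → Kind
dualKind OR  = AND
dualKind AND = OR

dualStatus : Status → Status
dualStatus solvable   = unsolvable
dualStatus unsolvable = solvable
dualStatus unknown    = unknown

dual : AOGraph → AOGraph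
dual G = record
  { V        = V G
  ; kind     = λ v → dualKind (kind G v)
  ; children = children G
  ; status   = λ v → dualStatus (status G v)
  }

dnGraph : ∀ {n} → CNF n → AOGraph
dnGraph φ = dual (pnGraph φ)

-- In the proof-number graph the root is an AND over one OR-gadget per
-- variable (children x_i and ¬x_i) and one OR-gadget per clause (its
-- literals, plus an unsolvable leaf so that the empty clause is never
-- solved).  A set of literal leaves solves the root iff it meets every
-- variable gadget and every clause.  Meeting all n variable gadgets needs at
-- least n literals, and with exactly n no variable can occur with both
-- signs, so such a set is a satisfying assignment; conversely a satisfying
-- assignment gives one true literal per variable.  Hence p(root) = n iff the
-- formula is satisfiable.  Swapping AND/OR and solvable/unsolvable turns
-- proofs into disproofs, which gives the statement for d(root).
module Submission where

open import Defs
open import Data.Nat using (ℕ; _≤_; _<_; z≤n; s≤s)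
import Data.Nat as ℕ
open import Data.Nat.Properties using (<-irrefl)
open import Data.Bool using (Bool; true; false)
open import Data.Fin using (Fin; zero; suc; _≟_)
open import Data.Fin.Properties using (injective⇒≤)
open import Data.List using (List; []; _∷_; _++_; map; length; lookup; allFin)
open import Data.List.Properties using (length-map; length-tabulate)
open import Data.List.Relation.Unary.All as All using (All; []; _∷_)
import Data.List.Relation.Unary.All.Properties as All
open import Data.List.Relation.Unary.Any as Any using (Any; here; there)
import Data.List.Relation.Unary.Any.Properties as Any
open import Data.List.Membership.Propositional using (_∈_)
open import Data.List.Relation.Unary.Unique.Propositional using (Unique)
open import Data.List.Membership.Propositional.Properties
  using (∈-map⁺; ∈-map⁻; ∈-++⁺ˡ; ∈-++⁺ʳ; ∈-lookup; ∈-allFin)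
import Data.List.Relation.Unary.Unique.Propositional.Properties as Unique
open import Data.Product using (Σ; ∃; _×_; _,_; proj₁; proj₂; map₂)
open import Data.Sum using (_⊎_; inj₁; inj₂)
open import Data.Empty using (⊥; ⊥-elim)
open import Relation.Nullary using (¬_; yes; no)
open import Relation.Binary.PropositionalEquality
open import Function.Definitions using (Injective)
open import Function.Bundles using (_⇔_; mk⇔)
open import Function.Construct.Composition using (_⇔-∘_)

module _ {ℓ n : ℕ} (h : Fin ℓ → Fin n) (hits : ∀ i → ∃ λ k → h k ≡ i) where

  private
    section : Fin n → Fin ℓ
    section i = proj₁ (hits i)

    h∘section : ∀ i → h (section i) ≡ i
    h∘section i = proj₂ (hits i)

    section-injective : Injective _≡_ _≡_ section
    section-injective {i} {j} eq =
      trans (sym (h∘section i)) (trans (cong h eq) (h∘section j))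

  surjection⇒≤ : n ≤ ℓ
  surjection⇒≤ = injective⇒≤ section-injective

  -- A second preimage of h p outside the section extends it to an
  -- injection Fin (suc n) → Fin ℓ.
  surjection-collision⇒< : ∀ {p q} → p ≢ q → h p ≡ h q → n < ℓ
  surjection-collision⇒< {p} {q} p≢q hp≡hq = injective⇒≤ extend-injective
    where
    spare : ∃ λ r → h r ≡ h p × r ≢ section (h p)
    spare with p ≟ section (h p)
    ... | yes p≡ = q , sym hp≡hq , λ q≡ → p≢q (trans p≡ (sym q≡))
    ... | no p≢  = p , refl , p≢

    r : Fin ℓ
    r = proj₁ spare

    r∉section : ∀ i → r ≢ section i
    r∉section i r≡ = proj₂ (proj₂ spare) (trans r≡ (cong section i≡hp))
      where
      i≡hp : i ≡ h p
      i≡hp = trans (sym (h∘section i)) (trans (cong h (sym r≡)) (proj₁ (proj₂ spare)))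

    extend : Fin (ℕ.suc n) → Fin ℓ
    extend zero    = r
    extend (suc i) = section i

    extend-injective : Injective _≡_ _≡_ extend
    extend-injective {zero}  {zero}  _  = refl
    extend-injective {zero}  {suc j} eq = ⊥-elim (r∉section j eq)
    extend-injective {suc i} {zero}  eq = ⊥-elim (r∉section i (sym eq))
    extend-injective {suc i} {suc j} eq = cong suc (section-injective eq)

All-fromLookup : ∀ {a p} {A : Set a} {P : A → Set p} {xs : List A} →
                 (∀ j → P (lookup xs j)) → All P xs
All-fromLookup {xs = []}     _ = []
All-fromLookup {xs = x ∷ xs} f = f zero ∷ All-fromLookup (λ j → f (suc j))

∈⇒lookup : ∀ {a} {A : Set a} {x : A} {xs : List A} → x ∈ xs → ∃ λ k → lookup xs k ≡ x
∈⇒lookup x∈xs = Any.index x∈xs , sym (Any.lookup-index x∈xs)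

module _ {n : ℕ} where

  varOf : Lit n → Fin n
  varOf (pos i) = i
  varOf (neg i) = i

  VarCover : List (Lit n) → Set
  VarCover L = ∀ i → pos i ∈ L ⊎ neg i ∈ L

  Consistent : List (Lit n) → Set
  Consistent L = ∀ i → pos i ∈ L → neg i ∈ L → ⊥

  module _ {L : List (Lit n)} (cover : VarCover L) where

    private
      varAt : Fin (length L) → Fin n
      varAt k = varOf (lookup L k)

      varAt-hits : ∀ {l} → l ∈ L → ∃ λ k → varAt k ≡ varOf l
      varAt-hits l∈L = map₂ (cong varOf) (∈⇒lookup l∈L)

      varAt-surjective : ∀ i → ∃ λ k → varAt k ≡ i
      varAt-surjective i with cover i
      ... | inj₁ pos∈L = varAt-hits pos∈L
      ... | inj₂ neg∈L = varAt-hits neg∈L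

    VarCover⇒≤ : n ≤ length L
    VarCover⇒≤ = surjection⇒≤ varAt varAt-surjective

    VarCover-exact⇒Consistent : length L ≡ n → Consistent L
    VarCover-exact⇒Consistent |L|≡n i pos∈L neg∈L = <-irrefl (sym |L|≡n) n<|L|
      where
      n<|L| : n < length L
      n<|L| with p , L[p]≡pos ← ∈⇒lookup pos∈L | q , L[q]≡neg ← ∈⇒lookup neg∈L =
        surjection-collision⇒< varAt varAt-surjective
          (λ { refl → pos≢neg (trans (sym L[p]≡pos) L[q]≡neg) })
          (trans (cong varOf L[p]≡pos) (cong varOf (sym L[q]≡neg)))
        where
        pos≢neg : pos i ≢ neg i
        pos≢neg ()

    coverAssignment : Fin n → Bool
    coverAssignment i with cover i
    ... | inj₁ _ = true
    ... | inj₂ _ = false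

    Consistent⇒coverAssignment-satisfies :
      Consistent L → ∀ {l} → l ∈ L → evalLit coverAssignment l ≡ true
    Consistent⇒coverAssignment-satisfies consistent {pos i} pos∈L with cover i
    ... | inj₁ _     = refl
    ... | inj₂ neg∈L = ⊥-elim (consistent i pos∈L neg∈L)
    Consistent⇒coverAssignment-satisfies consistent {neg i} neg∈L with cover i
    ... | inj₁ pos∈L = ⊥-elim (consistent i pos∈L neg∈L)
    ... | inj₂ _     = refl

  literal : Bool → Fin n → Lit n
  literal true  = pos
  literal false = neg

  varOf-literal : ∀ b i → varOf (literal b i) ≡ i
  varOf-literal true  i = refl
  varOf-literal false i = refl

  literal-varOf : ∀ ρ l → evalLit ρ l ≡ true → literal (ρ (varOf l)) (varOf l) ≡ l
  literal-varOf ρ (pos i) ρi≡true rewrite ρi≡true = refl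
  literal-varOf ρ (neg i) _ with ρ i
  ... | false = refl
  literal-varOf ρ (neg i) () | true

module _ {G : AOGraph} {S : List (V G)} {v : V G} where

  Solved-leaf⇒∈ : children G v ≡ [] → status G v ≢ solvable → Solved G S v → v ∈ S
  Solved-leaf⇒∈ _    ¬solvable (leaf-term _ v-solvable) = ⊥-elim (¬solvable v-solvable)
  Solved-leaf⇒∈ _    _         (leaf-S _ v∈S)           = v∈S
  Solved-leaf⇒∈ leaf _         (or-node _ any)          = ⊥-elim (Any.¬Any[] (subst (Any _) leaf any))
  Solved-leaf⇒∈ leaf _         (and-node _ nonleaf _)   = ⊥-elim (nonleaf leaf)

  Solved-OR⇒Any : kind G v ≡ OR → children G v ≢ [] → Solved G S v →
                  Any (Solved G S) (children G v)
  Solved-OR⇒Any _  nonleaf (leaf-term leaf _) = ⊥-elim (nonleaf leaf)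
  Solved-OR⇒Any _  nonleaf (leaf-S leaf _)    = ⊥-elim (nonleaf leaf)
  Solved-OR⇒Any _  _       (or-node _ any)    = any
  Solved-OR⇒Any or _       (and-node and _ _) with () ← trans (sym or) and

  Solved-AND⇒All : kind G v ≡ AND → Solved G S v → All (Solved G S) (children G v)
  Solved-AND⇒All _   (leaf-term leaf _) = subst (All _) (sym leaf) []
  Solved-AND⇒All _   (leaf-S leaf _)    = subst (All _) (sym leaf) []
  Solved-AND⇒All and (or-node or _)     with () ← trans (sym or) and
  Solved-AND⇒All _   (and-node _ _ all) = all

dualKind-flip : ∀ {k k′} → dualKind k ≡ k′ → k ≡ dualKind k′
dualKind-flip {OR}  refl = refl
dualKind-flip {AND} refl = refl

dualStatus-flip : ∀ {s s′} → dualStatus s ≡ s′ → s ≡ dualStatus s′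
dualStatus-flip {solvable}   refl = refl
dualStatus-flip {unsolvable} refl = refl
dualStatus-flip {unknown}    refl = refl

module _ (G : AOGraph) where

  mutual
    Solved⇒Disproved-dual : ∀ {S v} → Solved G S v → Disproved (dual G) S v
    Solved⇒Disproved-dual (leaf-term leaf s)      = leaf-term leaf (cong dualStatus s)
    Solved⇒Disproved-dual (leaf-S leaf v∈S)       = leaf-S leaf v∈S
    Solved⇒Disproved-dual (or-node k any)         = and-node (cong dualKind k) (Any-Solved⇒Disproved any)
    Solved⇒Disproved-dual (and-node k nonleaf all) =
      or-node (cong dualKind k) nonleaf (All-Solved⇒Disproved all)

    Any-Solved⇒Disproved : ∀ {S xs} → Any (Solved G S) xs → Any (Disproved (dual G) S) xs
    Any-Solved⇒Disproved (here p)  = here (Solved⇒Disproved-dual p)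
    Any-Solved⇒Disproved (there p) = there (Any-Solved⇒Disproved p)

    All-Solved⇒Disproved : ∀ {S xs} → All (Solved G S) xs → All (Disproved (dual G) S) xs
    All-Solved⇒Disproved []       = []
    All-Solved⇒Disproved (p ∷ ps) = Solved⇒Disproved-dual p ∷ All-Solved⇒Disproved ps

  mutual
    Disproved-dual⇒Solved : ∀ {S v} → Disproved (dual G) S v → Solved G S v
    Disproved-dual⇒Solved (leaf-term leaf s)       = leaf-term leaf (dualStatus-flip s)
    Disproved-dual⇒Solved (leaf-S leaf v∈S)        = leaf-S leaf v∈S
    Disproved-dual⇒Solved (or-node k nonleaf all)  =
      and-node (dualKind-flip k) nonleaf (All-Disproved⇒Solved all)
    Disproved-dual⇒Solved (and-node k any)         = or-node (dualKind-flip k) (Any-Disproved⇒Solved any)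

    Any-Disproved⇒Solved : ∀ {S xs} → Any (Disproved (dual G) S) xs → Any (Solved G S) xs
    Any-Disproved⇒Solved (here p)  = here (Disproved-dual⇒Solved p)
    Any-Disproved⇒Solved (there p) = there (Any-Disproved⇒Solved p)

    All-Disproved⇒Solved : ∀ {S xs} → All (Disproved (dual G) S) xs → All (Solved G S) xs
    All-Disproved⇒Solved []       = []
    All-Disproved⇒Solved (p ∷ ps) = Disproved-dual⇒Solved p ∷ All-Disproved⇒Solved ps

  Admissible⇒Admissible-dual : ∀ {S} → Admissible G S → Admissible (dual G) S
  Admissible⇒Admissible-dual (unique , leaves) =
    unique , All.map (λ (leaf , s) → leaf , cong dualStatus s) leaves

  Admissible-dual⇒Admissible : ∀ {S} → Admissible (dual G) S → Admissible G S
  Admissible-dual⇒Admissible (unique , leaves) =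
    unique , All.map (λ (leaf , s) → leaf , dualStatus-flip s) leaves

  ProofNumber⇔DisproofNumber-dual : ∀ x k → ProofNumber G x k ⇔ DisproofNumber (dual G) x k
  ProofNumber⇔DisproofNumber-dual x k = mk⇔
    (λ ((S , adm , |S|≡k , s) , minimal) →
       (S , Admissible⇒Admissible-dual adm , |S|≡k , Solved⇒Disproved-dual s) ,
       λ S′ adm′ d → minimal S′ (Admissible-dual⇒Admissible adm′) (Disproved-dual⇒Solved d))
    (λ ((S , adm , |S|≡k , d) , minimal) →
       (S , Admissible-dual⇒Admissible adm , |S|≡k , Disproved-dual⇒Solved d) ,
       λ S′ adm′ s → minimal S′ (Admissible⇒Admissible-dual adm′) (Solved⇒Disproved-dual s))

lit-injective : ∀ {n m} {l l′ : Lit n} → lit {m = m} l ≡ lit l′ → l ≡ l′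
lit-injective refl = refl

module _ {n : ℕ} (φ : CNF n) where

  private
    G : AOGraph
    G = pnGraph φ

    Node : Set
    Node = RNode n (length φ)

  pnGraph-finite : Finite G
  pnGraph-finite = nodes , node∈nodes
    where
    literals : List (Lit n)
    literals = map pos (allFin n) ++ map neg (allFin n)

    literal∈literals : ∀ l → l ∈ literals
    literal∈literals (pos i) = ∈-++⁺ˡ (∈-map⁺ pos (∈-allFin i))
    literal∈literals (neg i) = ∈-++⁺ʳ (map pos (allFin n)) (∈-map⁺ neg (∈-allFin i))

    gadgets : List Node
    gadgets = map var (allFin n) ++ map cls (allFin (length φ))

    nodes : List Node
    nodes = root ∷ tt ∷ ff ∷ map lit literals ++ gadgets

    node∈nodes : ∀ v → v ∈ nodes
    node∈nodes root    = here refl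
    node∈nodes tt      = there (here refl)
    node∈nodes ff      = there (there (here refl))
    node∈nodes (lit l) = there (there (there (∈-++⁺ˡ (∈-map⁺ lit (literal∈literals l)))))
    node∈nodes (var i) = there (there (there (∈-++⁺ʳ (map lit literals)
                           (∈-++⁺ˡ (∈-map⁺ var (∈-allFin i))))))
    node∈nodes (cls j) = there (there (there (∈-++⁺ʳ (map lit literals)
                           (∈-++⁺ʳ (map var (allFin n)) (∈-map⁺ cls (∈-allFin j))))))

  pnGraph-acyclic : Acyclic G
  pnGraph-acyclic = rank , λ v c c∈ → All.lookup (rank-decreases v) c∈
    where
    rank : Node → ℕ
    rank root    = 2
    rank (var _) = 1
    rank (cls _) = 1
    rank _       = 0

    rank-decreases : ∀ v → All (λ c → rank c < rank v) (children G v)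
    rank-decreases root    = s≤s z≤n ∷ All.++⁺ {xs = map var (allFin n)}
                                 (All.map⁺ (All.tabulate λ _ → s≤s (s≤s z≤n)))
                                 (All.map⁺ (All.tabulate λ _ → s≤s (s≤s z≤n)))
    rank-decreases tt      = []
    rank-decreases ff      = []
    rank-decreases (lit _) = []
    rank-decreases (var _) = s≤s z≤n ∷ s≤s z≤n ∷ []
    rank-decreases (cls _) = s≤s z≤n ∷ All.map⁺ (All.tabulate λ _ → s≤s z≤n)

  private
    var∈children-root : ∀ i → var i ∈ children G root
    var∈children-root i = there (∈-++⁺ˡ (∈-map⁺ var (∈-allFin i)))

    cls∈children-root : ∀ j → cls j ∈ children G root
    cls∈children-root j = there (∈-++⁺ʳ (map var (allFin n)) (∈-map⁺ cls (∈-allFin j)))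

    lit∈map⇒∈ : ∀ {L : List (Lit n)} {l} → lit {m = length φ} l ∈ map lit L → l ∈ L
    lit∈map⇒∈ p with l′ , l′∈L , eq ← ∈-map⁻ lit p =
      subst (_∈ _) (sym (lit-injective eq)) l′∈L

  NonTerminalLeaves⇒literals : ∀ {S : List Node} → All (NonTerminalLeaf G) S →
                               ∃ λ L → S ≡ map lit L
  NonTerminalLeaves⇒literals {S = []}        []             = [] , refl
  NonTerminalLeaves⇒literals {S = lit l ∷ S} (_ ∷ leaves)   =
    let L , S≡ = NonTerminalLeaves⇒literals leaves in l ∷ L , cong (lit l ∷_) S≡
  NonTerminalLeaves⇒literals {S = root ∷ _}  ((() , _) ∷ _)
  NonTerminalLeaves⇒literals {S = tt ∷ _}    ((_ , ()) ∷ _)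
  NonTerminalLeaves⇒literals {S = ff ∷ _}    ((_ , ()) ∷ _)
  NonTerminalLeaves⇒literals {S = var _ ∷ _} ((() , _) ∷ _)
  NonTerminalLeaves⇒literals {S = cls _ ∷ _} ((() , _) ∷ _)

  module _ {S : List Node} where

    Solved-lit⇒∈ : ∀ {l} → Solved G S (lit l) → lit l ∈ S
    Solved-lit⇒∈ = Solved-leaf⇒∈ refl (λ ())

    ff-unsolved : All (NonTerminalLeaf G) S → ¬ Solved G S ff
    ff-unsolved leaves s with () ← proj₂ (All.lookup leaves (Solved-leaf⇒∈ refl (λ ()) s))

    Solved-var⇒literal∈ : ∀ {i} → Solved G S (var i) → lit (pos i) ∈ S ⊎ lit (neg i) ∈ S
    Solved-var⇒literal∈ s with Solved-OR⇒Any refl (λ ()) s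
    ... | here p         = inj₁ (Solved-lit⇒∈ p)
    ... | there (here p) = inj₂ (Solved-lit⇒∈ p)

    Solved-cls⇒literal∈ : ∀ {j} → All (NonTerminalLeaf G) S → Solved G S (cls j) →
                  Any (λ l → lit l ∈ S) (lookup φ j)
    Solved-cls⇒literal∈ leaves s with Solved-OR⇒Any refl (λ ()) s
    ... | here p  = ⊥-elim (ff-unsolved leaves p)
    ... | there p = Any.map Solved-lit⇒∈ (Any.map⁻ p)

    solution⇒cover : Admissible G S → Solved G S root →
      ∃ λ L → S ≡ map lit L × VarCover L × All (Any (_∈ L)) φ
    solution⇒cover (_ , leaves) s with L , refl ← NonTerminalLeaves⇒literals leaves =
      L , refl , cover , All-fromLookup clause-hit
      where
      children-solved : All (Solved G S) (children G root)
      children-solved = Solved-AND⇒All refl s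

      cover : VarCover L
      cover i with Solved-var⇒literal∈ (All.lookup children-solved (var∈children-root i))
      ... | inj₁ p = inj₁ (lit∈map⇒∈ p)
      ... | inj₂ p = inj₂ (lit∈map⇒∈ p)

      clause-hit : ∀ j → Any (_∈ L) (lookup φ j)
      clause-hit j = Any.map lit∈map⇒∈
        (Solved-cls⇒literal∈ leaves (All.lookup children-solved (cls∈children-root j)))

    solution⇒n≤ : Admissible G S → Solved G S root → n ≤ length S
    solution⇒n≤ adm s with L , refl , cover , _ ← solution⇒cover adm s =
      subst (n ≤_) (sym (length-map lit L)) (VarCover⇒≤ cover)

    exact-solution⇒satisfiable : Admissible G S → length S ≡ n → Solved G S root → Satisfiable φ
    exact-solution⇒satisfiable adm |S|≡n s with L , refl , cover , clause-hits ← solution⇒cover adm s =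
      coverAssignment cover ,
      All.map (Any.map (Consistent⇒coverAssignment-satisfies cover consistent)) clause-hits
      where
      consistent : Consistent L
      consistent = VarCover-exact⇒Consistent cover (trans (sym (length-map lit L)) |S|≡n)

  assignment⇒solution : ∀ ρ → All (Any (λ l → evalLit ρ l ≡ true)) φ →
    Σ (List Node) λ S → Admissible G S × length S ≡ n × Solved G S root
  assignment⇒solution ρ sat = S , (unique , leaves) , |S|≡n ,
    and-node refl (λ ())
      (leaf-term refl refl ∷ All.++⁺ (All.map⁺ vars-solved) (All.map⁺ clauses-solved))
    where
    chosen : Fin n → Node
    chosen i = lit (literal (ρ i) i)

    S : List Node
    S = map chosen (allFin n)

    chosen∈S : ∀ i → chosen i ∈ S
    chosen∈S i = ∈-map⁺ chosen (∈-allFin i)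

    unique : Unique S
    unique = Unique.map⁺
      (λ {i} {j} eq → trans (sym (varOf-literal (ρ i) i))
                            (trans (cong varOf (lit-injective eq)) (varOf-literal (ρ j) j)))
      (Unique.allFin⁺ n)

    leaves : All (NonTerminalLeaf G) S
    leaves = All.map⁺ (All.universal (λ _ → refl , refl) _)

    |S|≡n : length S ≡ n
    |S|≡n = trans (length-map chosen (allFin n)) (length-tabulate (λ i → i))

    var-solved : ∀ i b → lit (literal b i) ∈ S → Solved G S (var i)
    var-solved i true  p = or-node refl (here (leaf-S refl p))
    var-solved i false p = or-node refl (there (here (leaf-S refl p)))

    vars-solved : All (λ i → Solved G S (var i)) (allFin n)
    vars-solved = All.universal (λ i → var-solved i (ρ i) (chosen∈S i)) _

    true-literal-chosen : ∀ {l} → evalLit ρ l ≡ true → lit l ∈ S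
    true-literal-chosen {l} ρl =
      subst (λ l′ → lit l′ ∈ S) (literal-varOf ρ l ρl) (chosen∈S (varOf l))

    clauses-solved : All (λ j → Solved G S (cls j)) (allFin (length φ))
    clauses-solved = All.universal (λ j → or-node refl (there (Any.map⁺
      (Any.map (λ ρl → leaf-S refl (true-literal-chosen ρl)) (All.lookup sat (∈-lookup j)))))) _

  satisfiable⇔ProofNumber : Satisfiable φ ⇔ ProofNumber G root n
  satisfiable⇔ProofNumber = mk⇔
    (λ (ρ , sat) → assignment⇒solution ρ sat , λ S adm s → solution⇒n≤ adm s)
    (λ ((S , adm , |S|≡n , s) , _) → exact-solution⇒satisfiable adm |S|≡n s)

theorem1 : (n : ℕ) (φ : CNF n) →
    (Finite (pnGraph φ) × Acyclic (pnGraph φ) ×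
      (Satisfiable φ ⇔ ProofNumber (pnGraph φ) root n)) ×
    (Finite (dnGraph φ) × Acyclic (dnGraph φ) ×
      (Satisfiable φ ⇔ DisproofNumber (dnGraph φ) root n))
theorem1 n φ =
  (pnGraph-finite φ , pnGraph-acyclic φ , satisfiable⇔ProofNumber φ) ,
  (pnGraph-finite φ , pnGraph-acyclic φ ,
   ProofNumber⇔DisproofNumber-dual (pnGraph φ) root n ⇔-∘ satisfiable⇔ProofNumber φ)
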